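{- Let $\approx$ be an SCER on $\Sigma^*$ and $T$ a string of length $n$. For any $1\le i\le n$ and any $j$ with $i-\mathit{Border}_T[i]\le j\le i$, we have $T[:j]\in\mathsf{LSeed}_{\approx}(T[:i])$.
   Context: $\Sigma^*$ is the set of strings over an alphabet $\Sigma$. For a string $T$, $|T|$ is its length, $T[i:j]$ the substring from position $i$ to $j$, $T[:j]=T[1:j]$, $T[i:]=T[i:|T|]$. An SCER is an equivalence relation $\approx$ on $\Sigma^*$ such that $X\approx Y$ implies $|X|=|Y|$ and $X[i:j]\approx Y[i:j]$ for all $1\le i\le j\le|X|$. $\mathsf{Occ}_{P,T}=\{\,i : 1\le i\le |T|-|P|+1,\ P\approx T[i:i+|P|-1]\,\}$. A string $B$ is a $\approx$-border of $T$ if $B\approx T[:|B|]\approx T[|T|-|B|+1:]$; proper if $|B|<|T|$. $\mathit{Border}_T[i]$ is the maximum length of a proper $\approx$-border of $T[:i]$ (the empty string counts). A string $C$ of length $c$ is a $\approx$-cover of $T$ of length $n$ if there are $x_1,\dots,x_m\in\mathsf{Occ}_{C,T}$ with $x_1=1$, $x_m=n-c+1$ and $x_{i-1}<x_i\le x_{i-1}+c$ for all $1<i\le m$; $\mathsf{Cov}_\approx(T)$ is the set of all $\approx$-covers of $T$. A string $S$ of length $m$ is a left $\approx$-seed of a string $T$ of length $n$ if there exist non-negative integers $k,l$ with $k\le l<m$, $S\in\mathsf{Cov}_\approx(T[:n-k])$ and $S[:l]\approx T[n-l+1:]$ (here $S[:0]$ and $T[n+1:]$ are empty). $\mathsf{LSeed}_\approx(T)$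 is the set of all left $\approx$-seeds of $T$. -}

module Defs where

open import Data.Nat using (ℕ; zero; suc; _+_; _∸_; _≤_; _<_)
open import Data.List using (List; length; take; drop; head; last)
open import Data.List.Relation.Unary.All using (All)
open import Data.List.Relation.Unary.Linked using (Linked)
open import Data.Maybe using (just)
open import Data.Product using (Σ; ∃; _×_; _,_)
open import Relation.Binary.Structures using (IsEquivalence)
open import Relation.Binary.PropositionalEquality using (_≡_)

-- Strings over an alphabet A are lists; positions are 1-based as in the paper.
-- T[i:j] = sub T i j  (for 1 ≤ i ≤ j ≤ |T|)
sub : {A : Set} → List A → ℕ → ℕ → List A
sub T i j = take (suc j ∸ i) (drop (i ∸ 1) T)

record SCER (A : Set) : Set₁ where
  field
    _≈_     : List A → List A → Set
    isEquiv : IsEquivalence _≈_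
    ≈-len   : ∀ {X Y} → X ≈ Y → length X ≡ length Y
    ≈-sub   : ∀ {X Y} → X ≈ Y → ∀ i j → 1 ≤ i → i ≤ j → j ≤ length X →
              sub X i j ≈ sub Y i j

module _ {A : Set} (R : SCER A) where
  open SCER R

  InOcc : List A → List A → ℕ → Set
  InOcc P T p = (1 ≤ p) × (p + length P ≤ length T + 1) ×
                (P ≈ take (length P) (drop (p ∸ 1) T))

  IsBorder : List A → List A → Set
  IsBorder B T = (B ≈ take (length B) T) ×
                 (B ≈ drop (length T ∸ length B) T)

  IsProperBorder : List A → List A → Set
  IsProperBorder B T = IsBorder B T × (length B < length T)

  IsBorderArr : List A → ℕ → ℕ → Set
  IsBorderArr T i b =
    (Σ (List A) λ B → IsProperBorder B (take i T) × (length B ≡ b)) ×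
    (∀ B → IsProperBorder B (take i T) → length B ≤ b)

  CoverStep : ℕ → ℕ → ℕ → Set
  CoverStep c x y = (x < y) × (y ≤ x + c)

  IsCover : List A → List A → Set
  IsCover C T = Σ (List ℕ) λ xs →
    (head xs ≡ just 1) ×
    (Σ ℕ λ xm → (last xs ≡ just xm) × (xm + length C ≡ length T + 1)) ×
    All (InOcc C T) xs ×
    Linked (CoverStep (length C)) xs

  IsLeftSeed : List A → List A → Set
  IsLeftSeed S T = Σ ℕ λ k → Σ ℕ λ l →
    (k ≤ l) × (l < length S) ×
    IsCover S (take (length T ∸ k) T) ×
    (take l S ≈ drop (length T ∸ l) T)

-- A proper border of length b makes p = i - b a ≈-period of U = T[:i], i.e. U[:i-p] ≈ U[p+1:].
-- Hence S = T[:j] recurs at positions 1, 1 + p, 1 + 2p, … as long as it fits into U, and these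
-- occurrences form a cover since p ≤ j. The part of U they miss is a suffix shorter than S,
-- which by periodicity is ≈ to a prefix of S. Inductively: drop p U is again p-periodic and
-- starts with S, so a left seed of it extends to U by one more occurrence in front.
module Submission where

open import Defs
open import Data.Nat using (ℕ; zero; suc; _+_; _∸_; _≤_; _<_; z≤n; s≤s; _≤?_)
open import Data.Nat.Properties
open import Data.Nat.Induction using (<-wellFounded)
open import Induction.WellFounded using (Acc; acc)
open import Data.List using (List; []; _∷_; length; take; drop; map)
open import Data.List.Properties
  using (length-take; length-drop; take-all; drop-all; take-take; drop-drop; take-[]; last-map)
open import Data.List.Relation.Unary.All using (_∷_; [])
import Data.List.Relation.Unary.All as All
import Data.List.Relation.Unary.All.Properties as AllP
open import Data.List.Relation.Unary.Linked using ([-]; _∷_)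
import Data.List.Relation.Unary.Linked as Linked
import Data.List.Relation.Unary.Linked.Properties as LinkedP
import Data.Maybe as Maybe
open import Data.Product using (_,_)
open import Relation.Nullary using (yes; no)
open import Relation.Binary.Bundles using (Setoid)
open import Relation.Binary.Structures using (IsEquivalence)
open import Relation.Binary.PropositionalEquality
  using (_≡_; refl; sym; trans; cong; cong₂; subst; subst₂; module ≡-Reasoning)
import Relation.Binary.Reasoning.Setoid as SetoidReasoning

module _ {A : Set} where

  length-take-≤ : ∀ m (xs : List A) → m ≤ length xs → length (take m xs) ≡ m
  length-take-≤ m xs m≤ = trans (length-take m xs) (m≤n⇒m⊓n≡m m≤)

  take-take-≤ : ∀ {m n} (xs : List A) → m ≤ n → take m (take n xs) ≡ take m xs
  take-take-≤ {m} {n} xs m≤n = trans (take-take m n xs) (cong (λ k → take k xs) (m≤n⇒m⊓n≡m m≤n))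

  drop-take : ∀ p m (xs : List A) → drop p (take m xs) ≡ take (m ∸ p) (drop p xs)
  drop-take zero    m       xs       = refl
  drop-take (suc p) zero    xs       = refl
  drop-take (suc p) (suc m) []       = sym (take-[] (m ∸ p))
  drop-take (suc p) (suc m) (x ∷ xs) = drop-take p m xs

  drop-suffix : ∀ p (xs : List A) {l} → l ≤ length (drop p xs) →
                drop (length (drop p xs) ∸ l) (drop p xs) ≡ drop (length xs ∸ l) xs
  drop-suffix zero    xs       l≤      = refl
  drop-suffix (suc p) []       z≤n     = refl
  drop-suffix (suc p) (x ∷ xs) {l} l≤ =
    trans (drop-suffix p xs l≤) (cong (λ k → drop k (x ∷ xs)) (sym (+-∸-assoc 1 l≤xs)))
    where
    l≤xs : l ≤ length xs
    l≤xs = ≤-trans l≤ (≤-trans (≤-reflexive (length-drop p xs)) (m∸n≤m _ p))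

module _ {A : Set} (R : SCER A) where
  open SCER R
  open IsEquivalence isEquiv renaming (refl to ≈-refl; sym to ≈-sym; trans to ≈-trans)

  ≈-setoid : Setoid _ _
  ≈-setoid = record { isEquivalence = isEquiv }

  module ≈-Reasoning = SetoidReasoning ≈-setoid

  ≡⇒≈ : ∀ {X Y} → X ≡ Y → X ≈ Y
  ≡⇒≈ refl = ≈-refl

  ≈-take : ∀ n {X Y} → X ≈ Y → take n X ≈ take n Y
  ≈-take zero    X≈Y = ≈-refl
  ≈-take (suc n) {X} {Y} X≈Y with suc n ≤? length X
  ... | yes n<X = ≈-sub X≈Y 1 (suc n) (s≤s z≤n) (s≤s z≤n) n<X
  ... | no  n≮X = subst₂ _≈_ (sym (take-all (suc n) X X≤n)) (sym (take-all (suc n) Y Y≤n)) X≈Y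
    where
    X≤n = ≤-trans (n≤1+n _) (≰⇒> n≮X)
    Y≤n = subst (_≤ suc n) (≈-len X≈Y) X≤n

  ≈-drop : ∀ n {X Y} → X ≈ Y → drop n X ≈ drop n Y
  ≈-drop n {X} {Y} X≈Y with suc n ≤? length X
  ... | yes n<X = subst₂ _≈_ (take-all _ (drop n X) (≤-reflexive (length-drop n X)))
                            (take-all _ (drop n Y) (≤-reflexive |dropY|))
                            (≈-sub X≈Y (suc n) (length X) (s≤s z≤n) n<X ≤-refl)
    where
    |dropY| : length (drop n Y) ≡ length X ∸ n
    |dropY| = trans (length-drop n Y) (cong (_∸ n) (sym (≈-len X≈Y)))
  ... | no  n≮X = subst₂ _≈_ (sym (drop-all n X X≤n)) (sym (drop-all n Y Y≤n)) ≈-refl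
    where
    X≤n = ≤-pred (≰⇒> n≮X)
    Y≤n = subst (_≤ n) (≈-len X≈Y) X≤n

  InOcc₁⁺ : ∀ {S U} → length S ≤ length U → S ≈ take (length S) U → InOcc R S U 1
  InOcc₁⁺ {S} {U} S≤U S≈ = ≤-refl , subst (suc (length S) ≤_) (+-comm 1 (length U)) (s≤s S≤U) , S≈

  InOcc₁⁻-length : ∀ {S U} → InOcc R S U 1 → length S ≤ length U
  InOcc₁⁻-length {S} {U} (_ , S+1≤U+1 , _) =
    ≤-pred (subst (suc (length S) ≤_) (+-comm (length U) 1) S+1≤U+1)

  InOcc₁⁻-≈ : ∀ {S U} → InOcc R S U 1 → S ≈ take (length S) U
  InOcc₁⁻-≈ (_ , _ , S≈) = S≈

  take-InOcc₁ : ∀ {j i} T → j ≤ i → i ≤ length T → InOcc R (take j T) (take i T) 1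
  take-InOcc₁ {j} {i} T j≤i i≤T =
    InOcc₁⁺ (subst₂ _≤_ (sym |S|≡j) (sym (length-take-≤ i T i≤T)) j≤i)
            (≡⇒≈ (sym (trans (cong (λ m → take m (take i T)) |S|≡j) (take-take-≤ T j≤i))))
    where
    |S|≡j : length (take j T) ≡ j
    |S|≡j = length-take-≤ j T (≤-trans j≤i i≤T)

  InOcc₁-take : ∀ {S U} m → InOcc R S U 1 → length S ≤ m → InOcc R S (take m U) 1
  InOcc₁-take {S} {U} m occ S≤m =
    InOcc₁⁺ (subst (length S ≤_) (sym (length-take m U)) (⊓-glb S≤m (InOcc₁⁻-length occ)))
            (≈-trans (InOcc₁⁻-≈ occ) (≡⇒≈ (sym (take-take-≤ U S≤m))))

  InOcc-drop : ∀ {S W} p {x} → p ≤ length W → InOcc R S (drop p W) x → InOcc R S W (p + x)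
  InOcc-drop {S} {W} p {x} p≤W (1≤x , x+S≤ , S≈) = ≤-trans 1≤x (m≤n+m x p) , p+x+S≤ , S≈′
    where
    open ≤-Reasoning
    p+x+S≤ : p + x + length S ≤ length W + 1
    p+x+S≤ = begin
      p + x + length S          ≡⟨ +-assoc p x (length S) ⟩
      p + (x + length S)        ≤⟨ +-monoʳ-≤ p x+S≤ ⟩
      p + (length (drop p W) + 1) ≡⟨ cong (λ m → p + (m + 1)) (length-drop p W) ⟩
      p + (length W ∸ p + 1)    ≡⟨ sym (+-assoc p _ 1) ⟩
      p + (length W ∸ p) + 1    ≡⟨ cong (_+ 1) (m+[n∸m]≡n p≤W) ⟩
      length W + 1              ∎
    S≈′ : S ≈ take (length S) (drop (p + x ∸ 1) W)
    S≈′ = subst (λ Y → S ≈ take (length S) Y)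
            (trans (drop-drop p (x ∸ 1) W) (cong (λ m → drop m W) (sym (+-∸-assoc p 1≤x)))) S≈

  IsCover⇒length≤ : ∀ {C T} → IsCover R C T → length C ≤ length T
  IsCover⇒length≤ ([]    , ()   , _)
  IsCover⇒length≤ (_ ∷ _ , refl , _ , occ ∷ _ , _) = InOcc₁⁻-length occ

  IsCover-refl : ∀ {S W} → S ≈ W → IsCover R S W
  IsCover-refl {S} {W} S≈W =
    1 ∷ [] , refl , (1 , refl , trans (cong suc |S|≡|W|) (+-comm 1 (length W))) ,
    InOcc₁⁺ (≤-reflexive |S|≡|W|)
            (subst (S ≈_) (sym (take-all _ W (≤-reflexive (sym |S|≡|W|)))) S≈W) ∷ [] ,
    [-]
    where
    |S|≡|W| = ≈-len S≈W

  IsCover-drop : ∀ {S W} p → 1 ≤ p → p ≤ length S → InOcc R S W 1 →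
                 IsCover R S (drop p W) → IsCover R S W
  IsCover-drop {S} {W} p 1≤p p≤S occ (xs@(_ ∷ _) , refl , (xm , last≡ , xm+S≡) , occs , steps) =
    1 ∷ map (p +_) xs , refl ,
    (p + xm , trans (last-map (p +_) xs) (cong (Maybe.map (p +_)) last≡) , p+xm+S≡) ,
    occ ∷ AllP.map⁺ (All.map (InOcc-drop p p≤W) occs) ,
    (m<n+m 1 1≤p , subst (_≤ suc (length S)) (+-comm 1 p) (s≤s p≤S)) ∷
      LinkedP.map⁺ (Linked.map shift steps)
    where
    p≤W : p ≤ length W
    p≤W = ≤-trans p≤S (InOcc₁⁻-length occ)
    shift : ∀ {x y} → CoverStep R (length S) x y → CoverStep R (length S) (p + x) (p + y)
    shift {x} {y} (x<y , y≤x+S) =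
      +-monoʳ-< p x<y , subst (p + y ≤_) (sym (+-assoc p x (length S))) (+-monoʳ-≤ p y≤x+S)
    open ≡-Reasoning
    p+xm+S≡ : p + xm + length S ≡ length W + 1
    p+xm+S≡ = begin
      p + xm + length S           ≡⟨ +-assoc p xm (length S) ⟩
      p + (xm + length S)         ≡⟨ cong (p +_) xm+S≡ ⟩
      p + (length (drop p W) + 1) ≡⟨ cong (λ m → p + (m + 1)) (length-drop p W) ⟩
      p + (length W ∸ p + 1)      ≡⟨ sym (+-assoc p _ 1) ⟩
      p + (length W ∸ p) + 1      ≡⟨ cong (_+ 1) (m+[n∸m]≡n p≤W) ⟩
      length W + 1                ∎

  IsLeftSeed-drop : ∀ {S U} p → 1 ≤ p → p ≤ length S → InOcc R S U 1 →
                    IsLeftSeed R S (drop p U) → IsLeftSeed R S U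
  IsLeftSeed-drop {S} {U} p 1≤p p≤S occ (k , l , k≤l , l<S , cover , l-suffix) =
    k , l , k≤l , l<S ,
    IsCover-drop p 1≤p p≤S (InOcc₁-take (length U ∸ k) occ S≤U∸k)
                 (subst (IsCover R S) (sym drop-W) cover) ,
    subst (take l S ≈_) (drop-suffix p U l≤U∸p) l-suffix
    where
    U∸p = length (drop p U)
    drop-W : drop p (take (length U ∸ k) U) ≡ take (U∸p ∸ k) (drop p U)
    drop-W = trans (drop-take p (length U ∸ k) U) (cong (λ m → take m (drop p U)) (begin
      length U ∸ k ∸ p   ≡⟨ ∸-+-assoc (length U) k p ⟩
      length U ∸ (k + p) ≡⟨ cong (length U ∸_) (+-comm k p) ⟩
      length U ∸ (p + k) ≡⟨ sym (∸-+-assoc (length U) p k) ⟩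
      length U ∸ p ∸ k   ≡⟨ cong (_∸ k) (sym (length-drop p U)) ⟩
      U∸p ∸ k            ∎))
      where open ≡-Reasoning
    S≤U∸p∸k : length S ≤ U∸p ∸ k
    S≤U∸p∸k = subst (length S ≤_) (length-take-≤ _ (drop p U) (m∸n≤m U∸p k)) (IsCover⇒length≤ cover)
    S≤U∸k : length S ≤ length U ∸ k
    S≤U∸k = ≤-trans S≤U∸p∸k (∸-monoˡ-≤ k (≤-trans (≤-reflexive (length-drop p U)) (m∸n≤m _ p)))
    l≤U∸p : l ≤ U∸p
    l≤U∸p = ≤-trans (<⇒≤ l<S) (≤-trans S≤U∸p∸k (m∸n≤m U∸p k))

  IsPeriod : ℕ → List A → Set
  IsPeriod p U = take (length U ∸ p) U ≈ drop p U

  IsBorder⇒IsPeriod : ∀ {B U} → IsBorder R B U → length B ≤ length U →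
                      IsPeriod (length U ∸ length B) U
  IsBorder⇒IsPeriod {B} {U} (B≈prefix , B≈suffix) B≤U =
    ≈-trans (≡⇒≈ (cong (λ m → take m U) (m∸[m∸n]≡n B≤U))) (≈-trans (≈-sym B≈prefix) B≈suffix)

  IsPeriod-drop : ∀ {U} p → IsPeriod p U → IsPeriod p (drop p U)
  IsPeriod-drop {U} p period = begin
    take (length (drop p U) ∸ p) (drop p U) ≡⟨ cong (λ m → take (m ∸ p) (drop p U)) (length-drop p U) ⟩
    take (length U ∸ p ∸ p) (drop p U)      ≡⟨ sym (drop-take p (length U ∸ p) U) ⟩
    drop p (take (length U ∸ p) U)          ≈⟨ ≈-drop p period ⟩
    drop p (drop p U)                       ∎
    where open ≈-Reasoning

  IsPeriod⇒take≈take-drop : ∀ {U} p m → IsPeriod p U → m + p ≤ length U →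
                            take m U ≈ take m (drop p U)
  IsPeriod⇒take≈take-drop {U} p m period m+p≤U = begin
    take m U                        ≡⟨ sym (take-take-≤ U (m+n≤o⇒m≤o∸n m m+p≤U)) ⟩
    take m (take (length U ∸ p) U)  ≈⟨ ≈-take m period ⟩
    take m (drop p U)               ∎
    where open ≈-Reasoning

  -- When S and its shift by p no longer fit into U, S covers U[:|S|] alone (k = |U| - |S|)
  -- and the missing suffix has length l = |U| - p.
  IsPeriod⇒IsLeftSeed-short : ∀ {S U} p → p ≤ length S → IsPeriod p U → InOcc R S U 1 →
                              length U < length S + p → IsLeftSeed R S U
  IsPeriod⇒IsLeftSeed-short {S} {U} p p≤S period occ U<S+p =
    length U ∸ length S , length U ∸ p , ∸-monoʳ-≤ (length U) p≤S , U∸p<S ,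
    subst (λ m → IsCover R S (take m U)) (sym (m∸[m∸n]≡n S≤U)) (IsCover-refl (InOcc₁⁻-≈ occ)) ,
    l-suffix
    where
    S≤U = InOcc₁⁻-length occ
    p≤U = ≤-trans p≤S S≤U
    U∸p<S : length U ∸ p < length S
    U∸p<S = subst (length U ∸ p <_) (m+n∸n≡m (length S) p) (∸-monoˡ-< U<S+p p≤U)
    open ≈-Reasoning
    l-suffix : take (length U ∸ p) S ≈ drop (length U ∸ (length U ∸ p)) U
    l-suffix = begin
      take (length U ∸ p) S                  ≈⟨ ≈-take _ (InOcc₁⁻-≈ occ) ⟩
      take (length U ∸ p) (take (length S) U) ≡⟨ take-take-≤ U (<⇒≤ U∸p<S) ⟩
      take (length U ∸ p) U                  ≈⟨ period ⟩
      drop p U                               ≡⟨ cong (λ m → drop m U) (sym (m∸[m∸n]≡n p≤U)) ⟩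
      drop (length U ∸ (length U ∸ p)) U     ∎

  IsPeriod⇒IsLeftSeed : ∀ {S} U p → 1 ≤ p → p ≤ length S → IsPeriod p U → InOcc R S U 1 →
                        IsLeftSeed R S U
  IsPeriod⇒IsLeftSeed U p = go U (<-wellFounded (length U))
    where
    go : ∀ {S} U → Acc _<_ (length U) → 1 ≤ p → p ≤ length S → IsPeriod p U → InOcc R S U 1 →
         IsLeftSeed R S U
    go {S} U (acc rec) 1≤p p≤S period occ with length S + p ≤? length U
    ... | no  S+p≰U = IsPeriod⇒IsLeftSeed-short p p≤S period occ (≰⇒> S+p≰U)
    ... | yes S+p≤U =
      IsLeftSeed-drop p 1≤p p≤S occ (go (drop p U) (rec shorter) 1≤p p≤S (IsPeriod-drop p period) occ′)
      where
      p≤U = ≤-trans (m≤n+m p (length S)) S+p≤U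
      shorter : length (drop p U) < length U
      shorter = subst (_< length U) (sym (length-drop p U)) (∸-monoʳ-< 1≤p p≤U)
      occ′ : InOcc R S (drop p U) 1
      occ′ = InOcc₁⁺ (subst (length S ≤_) (sym (length-drop p U)) (m+n≤o⇒m≤o∸n (length S) S+p≤U))
                     (≈-trans (InOcc₁⁻-≈ occ) (IsPeriod⇒take≈take-drop p (length S) period S+p≤U))

lemma11 : {A : Set} (R : SCER A) (T : List A) (i : ℕ) →
    1 ≤ i → i ≤ length T →
    (b : ℕ) → IsBorderArr R T i b →
    (j : ℕ) → i ∸ b ≤ j → j ≤ i →
    IsLeftSeed R (take j T) (take i T)
lemma11 R T i _ i≤T b ((B , (border , B<U) , |B|≡b) , _) j i∸b≤j j≤i =
  IsPeriod⇒IsLeftSeed R (take i T) (i ∸ b) (m<n⇒0<n∸m b<i) p≤S period (take-InOcc₁ R T j≤i i≤T)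
  where
  |U|≡i = length-take-≤ i T i≤T
  b<i : b < i
  b<i = subst₂ _<_ |B|≡b |U|≡i B<U
  p≤S : i ∸ b ≤ length (take j T)
  p≤S = subst (i ∸ b ≤_) (sym (length-take-≤ j T (≤-trans j≤i i≤T))) i∸b≤j
  period : IsPeriod R (i ∸ b) (take i T)
  period = subst (λ p → IsPeriod R p (take i T)) (cong₂ _∸_ |U|≡i |B|≡b)
                 (IsBorder⇒IsPeriod R border (<⇒≤ B<U))
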